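{- Let $K$ be an imaginary quadratic field in which the odd prime $p$ is inert, let $\mathcal{O}\subseteq\mathcal{O}_K$ be an order of discriminant $D$ with $p\nmid D$, and fix $\omega\in K$ with $\mathcal{O}=\mathbb{Z}+\omega\mathbb{Z}$. For an embedding $\iota$ of $\mathcal{O}$ into $M_{ns}$ write $\iota(\omega)=\left(\begin{smallmatrix} a&b\\ c&d\end{smallmatrix}\right)$ and let $v=[c,\,d-a,\,-b]$. Then $\iota\mapsto v$ is a bijection between the set of embeddings of $\mathcal{O}$ into $M_{ns}$ and $\mathcal{Q}_{ns,D}$. Moreover, $\iota$ is optimal if and only if $v$ is primitive (i.e. its coefficients have greatest common divisor $1$).
   Context: $\varepsilon$ is a fixed integer that is not a square modulo $p$ with $\varepsilon\equiv1\pmod 4$. $M_{ns}=\{\left(\begin{smallmatrix} a&b\\ c&d\end{smallmatrix}\right)\in M_2(\mathbb{Z}): a\equiv d,\ b\varepsilon\equiv c\pmod p\}$. An embedding of $\mathcal{O}$ into $M_{ns}$ is a $\mathbb{Q}$-algebra embedding $\iota:K\hookrightarrow M_2(\mathbb{Q})$ with $\iota(\mathcal{O})\subseteq M_{ns}$; it is optimal if $\iota(K)\cap M_{ns}=\iota(\mathcal{O})$. $[A,B,C]$ denotes the integral quadratic form $AX^2+BXY+CY^2$, and $\mathcal{Q}_{ns,D}=\{[A,B,C]: A,B,C\in\mathbb{Z},\ B^2-4AC=D,\ B\equiv A+C\varepsilon\equiv 0\pmod p\}$. -}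

module Defs where

open import Data.Nat as ℕ using (ℕ)
open import Data.Nat.GCD using (gcd)
open import Data.Integer as ℤ using (ℤ; +_; ∣_∣)
open import Data.Integer.Divisibility as ℤD using ()
open import Data.Rational as ℚ using (ℚ; 0ℚ; 1ℚ)
open import Data.Product using (Σ; _×_; _,_; ∃)
open import Relation.Binary.PropositionalEquality using (_≡_)
open import Relation.Nullary using (¬_)

toℚ : ℤ → ℚ
toℚ z = z ℚ./ 1

_≡_[mod_] : ℤ → ℤ → ℤ → Set
a ≡ b [mod m ] = m ℤD.∣ (a ℤ.- b)

IsSquareMod : ℤ → ℤ → Set
IsSquareMod x m = ∃ λ y → (y ℤ.* y) ≡ x [mod m ]

record M2 : Set where
  constructor mat
  field
    e11 e12 e21 e22 : ℚ

_+ᴹ_ : M2 → M2 → M2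
mat a b c d +ᴹ mat a' b' c' d' = mat (a ℚ.+ a') (b ℚ.+ b') (c ℚ.+ c') (d ℚ.+ d')

_*ᴹ_ : M2 → M2 → M2
mat a b c d *ᴹ mat a' b' c' d' =
  mat (a ℚ.* a' ℚ.+ b ℚ.* c') (a ℚ.* b' ℚ.+ b ℚ.* d')
      (c ℚ.* a' ℚ.+ d ℚ.* c') (c ℚ.* b' ℚ.+ d ℚ.* d')

_·ᴹ_ : ℚ → M2 → M2
q ·ᴹ mat a b c d = mat (q ℚ.* a) (q ℚ.* b) (q ℚ.* c) (q ℚ.* d)

Iᴹ : M2
Iᴹ = mat 1ℚ 0ℚ 0ℚ 1ℚ

intMat : ℤ → ℤ → ℤ → ℤ → M2
intMat a b c d = mat (toℚ a) (toℚ b) (toℚ c) (toℚ d)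

InMns : (p : ℕ) (ε : ℤ) → M2 → Set
InMns p ε M = Σ ℤ λ a → Σ ℤ λ b → Σ ℤ λ c → Σ ℤ λ d →
  (M ≡ intMat a b c d) × (a ≡ d [mod + p ]) × ((b ℤ.* ε) ≡ c [mod + p ])

-- The imaginary quadratic field K = ℚ(ω), where ω is a root of
-- X² - t X + n (t = tr ω, n = N ω ∈ ℤ, D = t² - 4n < 0).
-- An element x + y ω is represented by the pair (x , y).

record K : Set where
  constructor _+ω_
  field
    re : ℚ
    im : ℚ

module QuadField (t n : ℤ) where

  _+ᴷ_ : K → K → K
  (x +ω y) +ᴷ (x' +ω y') = (x ℚ.+ x') +ω (y ℚ.+ y')

  _*ᴷ_ : K → K → K
  (x +ω y) *ᴷ (x' +ω y') =
    (x ℚ.* x' ℚ.- toℚ n ℚ.* (y ℚ.* y'))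
      +ω (x ℚ.* y' ℚ.+ x' ℚ.* y ℚ.+ toℚ t ℚ.* (y ℚ.* y'))

  _·ᴷ_ : ℚ → K → K
  q ·ᴷ (x +ω y) = (q ℚ.* x) +ω (q ℚ.* y)

  1ᴷ : K
  1ᴷ = 1ℚ +ω 0ℚ

  ωᴷ : K
  ωᴷ = 0ℚ +ω 1ℚ

  ofO : ℤ → ℤ → K
  ofO x y = toℚ x +ω toℚ y

  InO : K → Set
  InO k = Σ ℤ λ x → Σ ℤ λ y → k ≡ ofO x y

  record IsQAlgEmbedding (ι : K → M2) : Set where
    field
      additive       : ∀ k l → ι (k +ᴷ l) ≡ ι k +ᴹ ι l
      multiplicative : ∀ k l → ι (k *ᴷ l) ≡ ι k *ᴹ ι l
      ℚ-linear       : ∀ q k → ι (q ·ᴷ k) ≡ q ·ᴹ ι k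
      unital         : ι 1ᴷ ≡ Iᴹ
      injective      : ∀ k l → ι k ≡ ι l → k ≡ l

  record EmbeddingIntoMns (p : ℕ) (ε : ℤ) : Set where
    field
      ι        : K → M2
      isEmb    : IsQAlgEmbedding ι
      OintoMns : ∀ x y → InMns p ε (ι (ofO x y))

  open EmbeddingIntoMns public

  -- optimal: ι(K) ∩ M_ns = ι(O)  (the inclusion ⊇ holds by OintoMns)
  Optimal : ∀ {p ε} → EmbeddingIntoMns p ε → Set
  Optimal {p} {ε} e =
    ∀ k → InMns p ε (ι e k) → Σ K λ o → InO o × (ι e k ≡ ι e o)

-- Binary quadratic forms [A,B,C] = A X² + B X Y + C Y²

record QForm : Set where
  constructor [_,_,_]
  field
    A B C : ℤ

disc : QForm → ℤ
disc [ A , B , C ] = B ℤ.* B ℤ.- + 4 ℤ.* A ℤ.* C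

InQnsD : (p : ℕ) (ε D : ℤ) → QForm → Set
InQnsD p ε D f@([ A , B , C ]) =
  (disc f ≡ D) × (B ≡ + 0 [mod + p ]) × ((A ℤ.+ C ℤ.* ε) ≡ + 0 [mod + p ])

Primitive : QForm → Set
Primitive [ A , B , C ] = gcd (gcd ∣ A ∣ ∣ B ∣) ∣ C ∣ ≡ 1

module _ (t n : ℤ) {p : ℕ} {ε : ℤ} where
  open QuadField t n

  formOf : EmbeddingIntoMns p ε → QForm
  formOf e with OintoMns e (+ 0) (+ 1)
  ... | a , b , c , d , _ = [ c , d ℤ.- a , ℤ.- b ]

{-# OPTIONS --safe #-}
module Submission where

-- An embedding ι is determined by M = ι ω = (a b ; c d), and ω² = t ω - n forces
-- M² = t M - n.  As D = t² - 4 n < 0, X² - t X + n has no integer root, so b ≠ 0;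
-- hence tr M = t, det M = n, and v = [c, d - a, -b] has discriminant
-- (a + d)² - 4 (a d - b c) = D.  Together with the trace, v determines M.
-- Conversely [A, B, C] ∈ 𝒬_{ns,D} forces t ≡ B (mod 2), and M = (h -C ; A h+B) with
-- h = (t - B)/2 has trace t and determinant n, so x + y ω ↦ x + y M is an embedding
-- with form [A, B, C]; the congruences defining 𝒬_{ns,D} are exactly those putting
-- ι(𝒪) inside M_ns.  If gcd v = 1, Bézout turns integrality of ι(x + y ω) into
-- y ∈ ℤ, whence x ∈ ℤ, so ι is optimal.  If g divides v, then g ∣ D, so p ∤ g and
-- ι((ω - a)/g) ∈ M_ns; optimality then gives 1/g ∈ ℤ.

open import Defs
open import Level using (0ℓ)
open import Function using (_∘_)
open import Function.Bundles using (_⇔_; mk⇔)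
open import Data.Nat as ℕ using (ℕ; zero; suc)
import Data.Nat.Properties as ℕP
import Data.Nat.Coprimality as Coprimality
import Data.Nat.Divisibility as ℕD
open import Data.Nat.GCD using (gcd; gcd-GCD; module Bézout; gcd[m,n]∣m; gcd[m,n]∣n; gcd[m,n]≡0⇒n≡0)
open import Data.Nat.Primality using (Prime; euclidsLemma; prime[2])
open import Data.Integer as ℤ using (ℤ; +_; -[1+_]; _-_; _*_; _<_; _+_; -_; ∣_∣)
import Data.Integer.Properties as ℤP
import Data.Integer.Divisibility as ℤD
open import Data.Integer.Divisibility using (_∣_)
import Data.Integer.Divisibility.Signed as ℤS
import Data.Integer.Tactic.RingSolver as ℤ-Solver
open import Data.Rational as ℚ using (ℚ; mkℚ; 0ℚ; 1ℚ)
import Data.Rational.Properties as ℚP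
open import Algebra.Properties.Group ℚP.+-0-group using (∙-cancelʳ)
import Tactic.RingSolver as RingSolver
import Tactic.RingSolver.Core.AlmostCommutativeRing as ACR
open import Data.Product using (Σ; _×_; _,_; proj₁; proj₂; ∃; ∃₂)
open import Data.Sum using (inj₁; inj₂)
open import Relation.Nullary using (¬_; contradiction)
open import Relation.Nullary.Decidable using (dec⇒maybe)
open import Relation.Binary.PropositionalEquality hiding ([_])

ℚ-ring : ACR.AlmostCommutativeRing 0ℓ 0ℓ
ℚ-ring = ACR.fromCommutativeRing ℚP.+-*-commutativeRing (λ x → dec⇒maybe (0ℚ ℚP.≟ x))

-- i / 1 is already in normal form, and in this form ℚ's + and * compute on integers.
toℚ≡mkℚ : ∀ i → toℚ i ≡ mkℚ i 0 (Coprimality.sym (Coprimality.1-coprimeTo ∣ i ∣))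
toℚ≡mkℚ i = ℚP.↥p/↧p≡p _

toℚ-injective : ∀ {i j} → toℚ i ≡ toℚ j → i ≡ j
toℚ-injective {i} {j} eq = cong ℚ.↥_ (trans (sym (toℚ≡mkℚ i)) (trans eq (toℚ≡mkℚ j)))

toℚ-* : ∀ i j → toℚ (i * j) ≡ toℚ i ℚ.* toℚ j
toℚ-* i j = sym (cong₂ ℚ._*_ (toℚ≡mkℚ i) (toℚ≡mkℚ j))

toℚ-+ : ∀ i j → toℚ (i + j) ≡ toℚ i ℚ.+ toℚ j
toℚ-+ i j = sym (trans (cong₂ ℚ._+_ (toℚ≡mkℚ i) (toℚ≡mkℚ j))
                       (cong (ℚ._/ 1) (cong₂ _+_ (ℤP.*-identityʳ i) (ℤP.*-identityʳ j))))

toℚ-neg : ∀ i → toℚ (- i) ≡ ℚ.- toℚ i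
toℚ-neg (+ zero)     = refl
toℚ-neg i@(+ suc _)  = trans (toℚ≡mkℚ (- i)) (cong ℚ.-_ (sym (toℚ≡mkℚ i)))
toℚ-neg i@(-[1+ _ ]) = trans (toℚ≡mkℚ (- i)) (cong ℚ.-_ (sym (toℚ≡mkℚ i)))

toℚ-sub : ∀ i j → toℚ (i - j) ≡ toℚ i ℚ.- toℚ j
toℚ-sub i j = trans (toℚ-+ i (- j)) (cong (toℚ i ℚ.+_) (toℚ-neg j))

toℚ-+* : ∀ x y a → toℚ (x + y * a) ≡ toℚ x ℚ.+ toℚ y ℚ.* toℚ a
toℚ-+* x y a = trans (toℚ-+ x (y * a)) (cong (toℚ x ℚ.+_) (toℚ-* y a))

toℚ-*+* : ∀ a b c d → toℚ (a * b + c * d) ≡ toℚ a ℚ.* toℚ b ℚ.+ toℚ c ℚ.* toℚ d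
toℚ-*+* a b c d = trans (toℚ-+ (a * b) (c * d)) (cong₂ ℚ._+_ (toℚ-* a b) (toℚ-* c d))

toℚ-*+*+* : ∀ u i v j w k →
  toℚ (u * i + v * j + w * k) ≡ toℚ u ℚ.* toℚ i ℚ.+ toℚ v ℚ.* toℚ j ℚ.+ toℚ w ℚ.* toℚ k
toℚ-*+*+* u i v j w k =
  trans (toℚ-+ (u * i + v * j) (w * k)) (cong₂ ℚ._+_ (toℚ-*+* u i v j) (toℚ-* w k))

0≤i*i : ∀ i → + 0 ℤ.≤ i * i
0≤i*i (+ n)    = subst (+ 0 ℤ.≤_) (ℤP.pos-* n n) (ℤ.+≤+ ℕ.z≤n)
0≤i*i -[1+ n ] = ℤ.+≤+ ℕ.z≤n

+∣i∣≡s*i : ∀ i → ∃ λ s → + ∣ i ∣ ≡ s * i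
+∣i∣≡s*i i with ℤP.+∣i∣≡i⊎+∣i∣≡-i i
... | inj₁ eq = + 1 , trans eq (sym (ℤP.*-identityˡ i))
... | inj₂ eq = - + 1 , trans eq (sym (ℤP.-1*i≡-i i))

private
  g+xm≡yn⇒g≡yn-xm : ∀ g x m y n → g ℕ.+ x ℕ.* m ≡ y ℕ.* n → + g ≡ + y * + n + - + x * + m
  g+xm≡yn⇒g≡yn-xm g x m y n eq = begin
    + g                                  ≡⟨ cancel (+ g) (+ x * + m) ⟨
    + g + + x * + m - + x * + m          ≡⟨ cong (λ z → z - + x * + m) pos-g+xm ⟨
    + (g ℕ.+ x ℕ.* m) - + x * + m        ≡⟨ cong (λ z → + z - + x * + m) eq ⟩
    + (y ℕ.* n) - + x * + m              ≡⟨ cong₂ _+_ (ℤP.pos-* y n) (ℤP.neg-distribˡ-* (+ x) (+ m)) ⟩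
    + y * + n + - + x * + m              ∎
    where
    open ≡-Reasoning
    cancel : ∀ g z → g + z - z ≡ g
    cancel = ℤ-Solver.solve-∀
    pos-g+xm : + (g ℕ.+ x ℕ.* m) ≡ + g + + x * + m
    pos-g+xm = trans (ℤP.pos-+ g (x ℕ.* m)) (cong (_+_ (+ g)) (ℤP.pos-* x m))

bézoutℕ : ∀ m n → ∃₂ λ u v → + gcd m n ≡ u * + m + v * + n
bézoutℕ m n with Bézout.identity (gcd-GCD m n)
... | Bézout.+- x y eq = + x , - + y , g+xm≡yn⇒g≡yn-xm (gcd m n) y n x m eq
... | Bézout.-+ x y eq = - + x , + y ,
  trans (g+xm≡yn⇒g≡yn-xm (gcd m n) x m y n eq) (ℤP.+-comm (+ y * + n) (- + x * + m))

bézout : ∀ i j → ∃₂ λ u v → + gcd ∣ i ∣ ∣ j ∣ ≡ u * i + v * j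
bézout i j =
  let u , v , eq = bézoutℕ ∣ i ∣ ∣ j ∣
      s , ∣i∣≡si = +∣i∣≡s*i i
      r , ∣j∣≡rj = +∣i∣≡s*i j
  in u * s , v * r , (begin
    + gcd ∣ i ∣ ∣ j ∣             ≡⟨ eq ⟩
    u * + ∣ i ∣ + v * + ∣ j ∣     ≡⟨ cong₂ (λ x y → u * x + v * y) ∣i∣≡si ∣j∣≡rj ⟩
    u * (s * i) + v * (r * j)     ≡⟨ reassoc u s i v r j ⟩
    u * s * i + v * r * j         ∎)
  where
  open ≡-Reasoning
  reassoc : ∀ u s i v r j → u * (s * i) + v * (r * j) ≡ u * s * i + v * r * j
  reassoc = ℤ-Solver.solve-∀

bézout₃ : ∀ i j k → ∃ λ u → ∃₂ λ v w → + gcd (gcd ∣ i ∣ ∣ j ∣) ∣ k ∣ ≡ u * i + v * j + w * k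
bézout₃ i j k =
  let u , w , eq = bézoutℕ (gcd ∣ i ∣ ∣ j ∣) ∣ k ∣
      u′ , v′ , eq′ = bézout i j
      r , ∣k∣≡rk = +∣i∣≡s*i k
  in u * u′ , u * v′ , w * r , (begin
    + gcd (gcd ∣ i ∣ ∣ j ∣) ∣ k ∣           ≡⟨ eq ⟩
    u * + gcd ∣ i ∣ ∣ j ∣ + w * + ∣ k ∣     ≡⟨ cong₂ (λ x y → u * x + w * y) eq′ ∣k∣≡rk ⟩
    u * (u′ * i + v′ * j) + w * (r * k)     ≡⟨ distrib u u′ i v′ j w r k ⟩
    u * u′ * i + u * v′ * j + w * r * k     ∎)
  where
  open ≡-Reasoning
  distrib : ∀ u u′ i v′ j w r k →
            u * (u′ * i + v′ * j) + w * (r * k) ≡ u * u′ * i + u * v′ * j + w * r * k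
  distrib = ℤ-Solver.solve-∀

p∣i*k⇒p∣i : ∀ {p} i k → Prime p → ¬ p ℕD.∣ ∣ k ∣ → + p ℤD.∣ i * k → + p ℤD.∣ i
p∣i*k⇒p∣i i k p-prime p∤k p∣ik
  with euclidsLemma ∣ i ∣ ∣ k ∣ p-prime (subst (_ ℕD.∣_) (ℤP.abs-* i k) p∣ik)
... | inj₁ p∣i = p∣i
... | inj₂ p∣k = contradiction p∣k p∤k

≡-mod-cancelʳ : ∀ {p} i j k → Prime p → ¬ p ℕD.∣ ∣ k ∣ →
                (i * k) ≡ (j * k) [mod + p ] → i ≡ j [mod + p ]
≡-mod-cancelʳ {p} i j k p-prime p∤k p∣ik-jk =
  p∣i*k⇒p∣i (i - j) k p-prime p∤k (subst (+ p ℤD.∣_) (distrib i j k) p∣ik-jk)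
  where
  distrib : ∀ i j k → i * k - j * k ≡ (i - j) * k
  distrib = ℤ-Solver.solve-∀

≡0-mod⇒∣ : ∀ {m i} → i ≡ + 0 [mod m ] → m ℤS.∣ i
≡0-mod⇒∣ {m} {i} h = subst (m ℤS.∣_) (ℤP.+-identityʳ i) (ℤS.∣ᵤ⇒∣ h)

∣⇒≡0-mod : ∀ {m i} → m ℤS.∣ i → i ≡ + 0 [mod m ]
∣⇒≡0-mod {m} {i} h = ℤS.∣⇒∣ᵤ (subst (m ℤS.∣_) (sym (ℤP.+-identityʳ i)) h)

2∣[i-j][i+j]⇒2∣i-j : ∀ i j → + 2 ℤS.∣ (i - j) * (i + j) → + 2 ℤS.∣ i - j
2∣[i-j][i+j]⇒2∣i-j i j 2∣ij
  with euclidsLemma ∣ i - j ∣ ∣ i + j ∣ prime[2]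
         (subst (2 ℕD.∣_) (ℤP.abs-* (i - j) (i + j)) (ℤS.∣⇒∣ᵤ 2∣ij))
... | inj₁ 2∣i-j = ℤS.∣ᵤ⇒∣ 2∣i-j
... | inj₂ 2∣i+j = subst (+ 2 ℤS.∣_) (sub-double i j)
                     (ℤS.∣m∣n⇒∣m-n (ℤS.∣ᵤ⇒∣ {+ 2} {i + j} 2∣i+j) (ℤS.∣m⇒∣m*n j (ℤS.∣-refl {+ 2})))
  where
  sub-double : ∀ i j → i + j - + 2 * j ≡ i - j
  sub-double = ℤ-Solver.solve-∀

negDisc⇒noRoot : ∀ t n a → t * t - + 4 * n < + 0 → a * a + n ≢ t * a
negDisc⇒noRoot t n a disc<0 root =
  ℤP.<⇒≱ disc<0 (subst (+ 0 ℤ.≤_) square≡disc (0≤i*i (+ 2 * a - t)))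
  where
  open ≡-Reasoning
  complete : ∀ a t n → (+ 2 * a - t) * (+ 2 * a - t) ≡ t * t - + 4 * n + + 4 * (a * a + n - t * a)
  complete = ℤ-Solver.solve-∀
  square≡disc : (+ 2 * a - t) * (+ 2 * a - t) ≡ t * t - + 4 * n
  square≡disc = begin
    (+ 2 * a - t) * (+ 2 * a - t)                   ≡⟨ complete a t n ⟩
    t * t - + 4 * n + + 4 * (a * a + n - t * a)     ≡⟨ cong (λ x → t * t - + 4 * n + + 4 * (x - t * a)) root ⟩
    t * t - + 4 * n + + 4 * (t * a - t * a)         ≡⟨ cong (λ x → t * t - + 4 * n + + 4 * x) (ℤP.+-inverseʳ (t * a)) ⟩
    t * t - + 4 * n + + 4 * + 0                     ≡⟨ ℤP.+-identityʳ (t * t - + 4 * n) ⟩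
    t * t - + 4 * n                                 ∎

disc[c,d-a,-b] : ∀ a b c d → disc [ c , d - a , - b ] ≡ (a + d) * (a + d) - + 4 * (a * d - b * c)
disc[c,d-a,-b] = expand
  where
  expand : ∀ a b c d → (d - a) * (d - a) - + 4 * c * (- b) ≡ (a + d) * (a + d) - + 4 * (a * d - b * c)
  expand = ℤ-Solver.solve-∀

record HasCharPoly (t n a b c d : ℤ) : Set where
  constructor mkHasCharPoly
  field
    trace : a + d ≡ t
    det   : a * d - b * c ≡ n

hasCharPoly⇒disc : ∀ {t n a b c d} → HasCharPoly t n a b c d → disc [ c , d - a , - b ] ≡ t * t - + 4 * n
hasCharPoly⇒disc {a = a} {b} {c} {d} (mkHasCharPoly refl refl) = disc[c,d-a,-b] a b c d

hasCharPoly⇒b≢0 : ∀ {t n a b c d} → t * t - + 4 * n < + 0 → HasCharPoly t n a b c d → b ≢ + 0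
hasCharPoly⇒b≢0 {a = a} {c = c} {d} disc<0 (mkHasCharPoly refl refl) refl =
  negDisc⇒noRoot (a + d) (a * d - + 0 * c) a disc<0 (root a c d)
  where
  root : ∀ a c d → a * a + (a * d - + 0 * c) ≡ (a + d) * a
  root = ℤ-Solver.solve-∀

cayleyHamilton⇒hasCharPoly : ∀ {t n a b c d} → t * t - + 4 * n < + 0 →
  a * a + b * c ≡ - n + t * a → a * b + b * d ≡ t * b → HasCharPoly t n a b c d
cayleyHamilton⇒hasCharPoly {t} {n} {a} {b} {c} {d} disc<0 ch₁₁ ch₁₂ = mkHasCharPoly trace (det trace)
  where
  open ≡-Reasoning
  b≢0 : b ≢ + 0
  b≢0 refl = negDisc⇒noRoot t n a disc<0 (begin
    a * a + n                        ≡⟨ cong (_+ n) (trans (sym (ℤP.+-identityʳ (a * a))) ch₁₁) ⟩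
    - n + t * a + n                  ≡⟨ cancel n (t * a) ⟩
    t * a                            ∎)
    where
    cancel : ∀ n x → - n + x + n ≡ x
    cancel = ℤ-Solver.solve-∀
  trace : a + d ≡ t
  trace = ℤP.*-cancelˡ-≡ b (a + d) t {{ℤ.≢-nonZero b≢0}} (begin
    b * (a + d)     ≡⟨ distrib a b d ⟩
    a * b + b * d   ≡⟨ ch₁₂ ⟩
    t * b           ≡⟨ ℤP.*-comm t b ⟩
    b * t           ∎)
    where
    distrib : ∀ a b d → b * (a + d) ≡ a * b + b * d
    distrib = ℤ-Solver.solve-∀
  det : a + d ≡ t → a * d - b * c ≡ n
  det refl = begin
    a * d - b * c                       ≡⟨ expand a b c d ⟩
    (a + d) * a - (a * a + b * c)       ≡⟨ cong (_-_ ((a + d) * a)) ch₁₁ ⟩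
    (a + d) * a - (- n + (a + d) * a)   ≡⟨ cancel n ((a + d) * a) ⟩
    n                                   ∎
    where
    expand : ∀ a b c d → a * d - b * c ≡ (a + d) * a - (a * a + b * c)
    expand = ℤ-Solver.solve-∀
    cancel : ∀ n x → x - (- n + x) ≡ n
    cancel = ℤ-Solver.solve-∀

∣-disc : ∀ {k A B C} → k ℤS.∣ A → k ℤS.∣ B → k ℤS.∣ C → k ℤS.∣ disc [ A , B , C ]
∣-disc {A = A} {B} k∣A k∣B k∣C = ℤS.∣m∣n⇒∣m-n (ℤS.∣m⇒∣m*n B k∣B) (ℤS.∣n⇒∣m*n (+ 4 * A) k∣C)

content : QForm → ℕ
content [ A , B , C ] = gcd (gcd ∣ A ∣ ∣ B ∣) ∣ C ∣

content∣A : ∀ A B C → + content [ A , B , C ] ℤS.∣ A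
content∣A A B C = ℤS.∣ᵤ⇒∣ (ℕD.∣-trans (gcd[m,n]∣m (gcd ∣ A ∣ ∣ B ∣) ∣ C ∣) (gcd[m,n]∣m ∣ A ∣ ∣ B ∣))

content∣B : ∀ A B C → + content [ A , B , C ] ℤS.∣ B
content∣B A B C = ℤS.∣ᵤ⇒∣ (ℕD.∣-trans (gcd[m,n]∣m (gcd ∣ A ∣ ∣ B ∣) ∣ C ∣) (gcd[m,n]∣n ∣ A ∣ ∣ B ∣))

content∣C : ∀ A B C → + content [ A , B , C ] ℤS.∣ C
content∣C A B C = ℤS.∣ᵤ⇒∣ (gcd[m,n]∣n (gcd ∣ A ∣ ∣ B ∣) ∣ C ∣)

content≡0⇒C≡0 : ∀ A B C → content [ A , B , C ] ≡ 0 → C ≡ + 0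
content≡0⇒C≡0 A B C = ℤP.∣i∣≡0⇒i≡0 ∘ gcd[m,n]≡0⇒n≡0 (gcd ∣ A ∣ ∣ B ∣)

mat-cong : ∀ {a b c d a′ b′ c′ d′} → a ≡ a′ → b ≡ b′ → c ≡ c′ → d ≡ d′ → mat a b c d ≡ mat a′ b′ c′ d′
mat-cong refl refl refl refl = refl

-- x + y ω ↦ x I + y M
substω : M2 → K → M2
substω (mat α β γ δ) (x +ω y) = mat (x ℚ.+ y ℚ.* α) (y ℚ.* β) (y ℚ.* γ) (x ℚ.+ y ℚ.* δ)

private
  x*1+y*α≡x+y*α : ∀ x y α → x ℚ.* 1ℚ ℚ.+ y ℚ.* α ≡ x ℚ.+ y ℚ.* α
  x*1+y*α≡x+y*α x y α = cong (ℚ._+ y ℚ.* α) (ℚP.*-identityʳ x)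

  x*0+y*β≡y*β : ∀ x y β → x ℚ.* 0ℚ ℚ.+ y ℚ.* β ≡ y ℚ.* β
  x*0+y*β≡y*β x y β = trans (cong (ℚ._+ y ℚ.* β) (ℚP.*-zeroʳ x)) (ℚP.+-identityˡ (y ℚ.* β))

  x*1+y*0≡x : ∀ x y → x ℚ.* 1ℚ ℚ.+ y ℚ.* 0ℚ ≡ x
  x*1+y*0≡x x y = trans (cong (x ℚ.* 1ℚ ℚ.+_) (ℚP.*-zeroʳ y)) (trans (ℚP.+-identityʳ _) (ℚP.*-identityʳ x))

*-cancelʳ-≢0 : ∀ {β} y y′ → β ≢ 0ℚ → y ℚ.* β ≡ y′ ℚ.* β → y ≡ y′
*-cancelʳ-≢0 {β} y y′ β≢0 yβ≡y′β = begin
  y                        ≡⟨ cancel y ⟨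
  y ℚ.* β ℚ.* ℚ.1/ β       ≡⟨ cong (ℚ._* ℚ.1/ β) yβ≡y′β ⟩
  y′ ℚ.* β ℚ.* ℚ.1/ β      ≡⟨ cancel y′ ⟩
  y′                       ∎
  where
  open ≡-Reasoning
  instance _ = ℚ.≢-nonZero β≢0
  cancel : ∀ z → z ℚ.* β ℚ.* ℚ.1/ β ≡ z
  cancel z = begin
    z ℚ.* β ℚ.* ℚ.1/ β       ≡⟨ ℚP.*-assoc z β (ℚ.1/ β) ⟩
    z ℚ.* (β ℚ.* ℚ.1/ β)     ≡⟨ cong (z ℚ.*_) (ℚP.*-inverseʳ β) ⟩
    z ℚ.* 1ℚ                 ≡⟨ ℚP.*-identityʳ z ⟩
    z                        ∎

module _ {t n : ℤ} where
  open QuadField t n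

  ω*ω : ωᴷ *ᴷ ωᴷ ≡ toℚ (- n) +ω toℚ t
  ω*ω = cong₂ _+ω_ (trans (real-part (toℚ n)) (sym (toℚ-neg n))) (ω-part (toℚ t))
    where
    real-part : ∀ N → 0ℚ ℚ.* 0ℚ ℚ.- N ℚ.* (1ℚ ℚ.* 1ℚ) ≡ ℚ.- N
    real-part = RingSolver.solve-∀ ℚ-ring
    ω-part : ∀ T → 0ℚ ℚ.* 1ℚ ℚ.+ 0ℚ ℚ.* 1ℚ ℚ.+ T ℚ.* (1ℚ ℚ.* 1ℚ) ≡ T
    ω-part = RingSolver.solve-∀ ℚ-ring

  xI+yM≡substω : ∀ x y M → (x ·ᴹ Iᴹ) +ᴹ (y ·ᴹ M) ≡ substω M (x +ω y)
  xI+yM≡substω x y (mat α β γ δ) =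
    mat-cong (x*1+y*α≡x+y*α x y α) (x*0+y*β≡y*β x y β) (x*0+y*β≡y*β x y γ) (x*1+y*α≡x+y*α x y δ)

  ι≗substω[ιω] : ∀ {ι} → IsQAlgEmbedding ι → ∀ k → ι k ≡ substω (ι ωᴷ) k
  ι≗substω[ιω] {ι} isEmb (x +ω y) = begin
    ι (x +ω y)                          ≡⟨ cong ι decompose ⟨
    ι ((x ·ᴷ 1ᴷ) +ᴷ (y ·ᴷ ωᴷ))          ≡⟨ additive (x ·ᴷ 1ᴷ) (y ·ᴷ ωᴷ) ⟩
    ι (x ·ᴷ 1ᴷ) +ᴹ ι (y ·ᴷ ωᴷ)          ≡⟨ cong₂ _+ᴹ_ (ℚ-linear x 1ᴷ) (ℚ-linear y ωᴷ) ⟩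
    (x ·ᴹ ι 1ᴷ) +ᴹ (y ·ᴹ ι ωᴷ)          ≡⟨ cong (λ I → (x ·ᴹ I) +ᴹ (y ·ᴹ ι ωᴷ)) unital ⟩
    (x ·ᴹ Iᴹ) +ᴹ (y ·ᴹ ι ωᴷ)            ≡⟨ xI+yM≡substω x y (ι ωᴷ) ⟩
    substω (ι ωᴷ) (x +ω y)              ∎
    where
    open ≡-Reasoning
    open IsQAlgEmbedding isEmb
    decompose : (x ·ᴷ 1ᴷ) +ᴷ (y ·ᴷ ωᴷ) ≡ x +ω y
    decompose = cong₂ _+ω_ (x*1+y*0≡x x y) (trans (x*0+y*β≡y*β x y 1ℚ) (ℚP.*-identityʳ y))

  substω-isQAlgEmbedding : ∀ {α β γ δ} → toℚ t ≡ α ℚ.+ δ → toℚ n ≡ α ℚ.* δ ℚ.- β ℚ.* γ → β ≢ 0ℚ →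
                           IsQAlgEmbedding (substω (mat α β γ δ))
  substω-isQAlgEmbedding {α} {β} {γ} {δ} trace det β≢0 = record
    { additive       = λ { (x +ω y) (x′ +ω y′) →
        mat-cong (+-diag x x′ y y′ α) (ℚP.*-distribʳ-+ β y y′) (ℚP.*-distribʳ-+ γ y y′) (+-diag x x′ y y′ δ) }
    ; multiplicative = multiplicative
    ; ℚ-linear       = λ { q (x +ω y) → mat-cong (·-diag q x y α) (ℚP.*-assoc q y β) (ℚP.*-assoc q y γ) (·-diag q x y δ) }
    ; unital         = mat-cong (1-diag α) (ℚP.*-zeroˡ β) (ℚP.*-zeroˡ γ) (1-diag δ)
    ; injective      = injective
    }
    where
    M = mat α β γ δ
    +-diag : ∀ x x′ y y′ α → (x ℚ.+ x′) ℚ.+ (y ℚ.+ y′) ℚ.* α ≡ (x ℚ.+ y ℚ.* α) ℚ.+ (x′ ℚ.+ y′ ℚ.* α)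
    +-diag = RingSolver.solve-∀ ℚ-ring
    ·-diag : ∀ q x y α → q ℚ.* x ℚ.+ q ℚ.* y ℚ.* α ≡ q ℚ.* (x ℚ.+ y ℚ.* α)
    ·-diag = RingSolver.solve-∀ ℚ-ring
    1-diag : ∀ α → 1ℚ ℚ.+ 0ℚ ℚ.* α ≡ 1ℚ
    1-diag α = trans (cong (1ℚ ℚ.+_) (ℚP.*-zeroˡ α)) (ℚP.+-identityʳ 1ℚ)

    -- once t = α + δ and n = α δ - β γ are substituted, each entry is an instance of
    -- the Cayley–Hamilton identity M² = t M - n
    multiplicative : ∀ k l → substω M (k *ᴷ l) ≡ substω M k *ᴹ substω M l
    multiplicative (x +ω y) (x′ +ω y′) = trans
      (cong₂ (λ T N → substω M ((x ℚ.* x′ ℚ.- N ℚ.* (y ℚ.* y′)) +ω (x ℚ.* y′ ℚ.+ x′ ℚ.* y ℚ.+ T ℚ.* (y ℚ.* y′))))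
             trace det)
      (mat-cong (e₁₁ x y x′ y′ α β γ δ) (e₁₂ x y x′ y′ α β δ) (e₂₁ x y x′ y′ α γ δ) (e₂₂ x y x′ y′ α β γ δ))
      where
      e₁₁ : ∀ x y x′ y′ α β γ δ →
        (x ℚ.* x′ ℚ.- (α ℚ.* δ ℚ.- β ℚ.* γ) ℚ.* (y ℚ.* y′)) ℚ.+ (x ℚ.* y′ ℚ.+ x′ ℚ.* y ℚ.+ (α ℚ.+ δ) ℚ.* (y ℚ.* y′)) ℚ.* α
        ≡ (x ℚ.+ y ℚ.* α) ℚ.* (x′ ℚ.+ y′ ℚ.* α) ℚ.+ (y ℚ.* β) ℚ.* (y′ ℚ.* γ)
      e₁₁ = RingSolver.solve-∀ ℚ-ring
      e₁₂ : ∀ x y x′ y′ α β δ →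
        (x ℚ.* y′ ℚ.+ x′ ℚ.* y ℚ.+ (α ℚ.+ δ) ℚ.* (y ℚ.* y′)) ℚ.* β
        ≡ (x ℚ.+ y ℚ.* α) ℚ.* (y′ ℚ.* β) ℚ.+ (y ℚ.* β) ℚ.* (x′ ℚ.+ y′ ℚ.* δ)
      e₁₂ = RingSolver.solve-∀ ℚ-ring
      e₂₁ : ∀ x y x′ y′ α γ δ →
        (x ℚ.* y′ ℚ.+ x′ ℚ.* y ℚ.+ (α ℚ.+ δ) ℚ.* (y ℚ.* y′)) ℚ.* γ
        ≡ (y ℚ.* γ) ℚ.* (x′ ℚ.+ y′ ℚ.* α) ℚ.+ (x ℚ.+ y ℚ.* δ) ℚ.* (y′ ℚ.* γ)
      e₂₁ = RingSolver.solve-∀ ℚ-ring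
      e₂₂ : ∀ x y x′ y′ α β γ δ →
        (x ℚ.* x′ ℚ.- (α ℚ.* δ ℚ.- β ℚ.* γ) ℚ.* (y ℚ.* y′)) ℚ.+ (x ℚ.* y′ ℚ.+ x′ ℚ.* y ℚ.+ (α ℚ.+ δ) ℚ.* (y ℚ.* y′)) ℚ.* δ
        ≡ (y ℚ.* γ) ℚ.* (y′ ℚ.* β) ℚ.+ (x ℚ.+ y ℚ.* δ) ℚ.* (x′ ℚ.+ y′ ℚ.* δ)
      e₂₂ = RingSolver.solve-∀ ℚ-ring

    injective : ∀ k l → substω M k ≡ substω M l → k ≡ l
    injective (x +ω y) (x′ +ω y′) eq = cong₂ _+ω_ (∙-cancelʳ (y ℚ.* α) x x′ x+yα≡x′+yα) y≡y′
      where
      y≡y′ = *-cancelʳ-≢0 y y′ β≢0 (cong M2.e12 eq)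
      x+yα≡x′+yα : x ℚ.+ y ℚ.* α ≡ x′ ℚ.+ y ℚ.* α
      x+yα≡x′+yα = trans (cong M2.e11 eq) (cong (λ z → x′ ℚ.+ z ℚ.* α) (sym y≡y′))

substω-intMat : ∀ a b c d x y →
  substω (intMat a b c d) (toℚ x +ω toℚ y) ≡ intMat (x + y * a) (y * b) (y * c) (x + y * d)
substω-intMat a b c d x y =
  sym (mat-cong (toℚ-+* x y a) (toℚ-* y b) (toℚ-* y c) (toℚ-+* x y d))

intMat-* : ∀ a b c d a′ b′ c′ d′ → intMat a b c d *ᴹ intMat a′ b′ c′ d′ ≡
  intMat (a * a′ + b * c′) (a * b′ + b * d′) (c * a′ + d * c′) (c * b′ + d * d′)
intMat-* a b c d a′ b′ c′ d′ =
  sym (mat-cong (toℚ-*+* a a′ b c′) (toℚ-*+* a b′ b d′) (toℚ-*+* c a′ d c′) (toℚ-*+* c b′ d d′))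

substω-intMat-isQAlgEmbedding : ∀ {t n a b c d} → HasCharPoly t n a b c d → b ≢ + 0 →
                                QuadField.IsQAlgEmbedding t n (substω (intMat a b c d))
substω-intMat-isQAlgEmbedding {a = a} {b} {c} {d} (mkHasCharPoly refl refl) b≢0 =
  substω-isQAlgEmbedding (toℚ-+ a d)
    (trans (toℚ-sub (a * d) (b * c)) (cong₂ ℚ._-_ (toℚ-* a d) (toℚ-* b c)))
    (b≢0 ∘ toℚ-injective)

hasCharPoly-form-injective : ∀ {t n a b c d a′ b′ c′ d′} →
  HasCharPoly t n a b c d → HasCharPoly t n a′ b′ c′ d′ →
  [ c , d - a , - b ] ≡ [ c′ , d′ - a′ , - b′ ] → intMat a b c d ≡ intMat a′ b′ c′ d′
hasCharPoly-form-injective {a = a} {b} {c} {d} {a′} {b′} {c′} {d′}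
  (mkHasCharPoly refl _) (mkHasCharPoly tr′ _) form≡form′ =
  mat-cong (cong toℚ a≡a′) (cong toℚ (ℤP.neg-injective (cong QForm.C form≡form′)))
           (cong toℚ (cong QForm.A form≡form′)) (cong toℚ d≡d′)
  where
  open ≡-Reasoning
  double : ∀ a d → a * + 2 ≡ (a + d) - (d - a)
  double = ℤ-Solver.solve-∀
  a≡a′ : a ≡ a′
  a≡a′ = ℤP.*-cancelʳ-≡ a a′ (+ 2) (begin
    a * + 2                ≡⟨ double a d ⟩
    (a + d) - (d - a)      ≡⟨ cong₂ _-_ (sym tr′) (cong QForm.B form≡form′) ⟩
    (a′ + d′) - (d′ - a′)  ≡⟨ double a′ d′ ⟨
    a′ * + 2               ∎)
  recover-d : ∀ a d → d ≡ (a + d) - a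
  recover-d = ℤ-Solver.solve-∀
  d≡d′ : d ≡ d′
  d≡d′ = begin
    d                ≡⟨ recover-d a d ⟩
    (a + d) - a      ≡⟨ cong₂ _-_ (sym tr′) a≡a′ ⟩
    (a′ + d′) - a′   ≡⟨ recover-d a′ d′ ⟨
    d′               ∎

∈ℤ-if-coprime-multiples-∈ℤ : ∀ i j k → content [ i , j , k ] ≡ 1 →
  ∀ {y i′ j′ k′} → y ℚ.* toℚ i ≡ toℚ i′ → y ℚ.* toℚ j ≡ toℚ j′ → y ℚ.* toℚ k ≡ toℚ k′ →
  ∃ λ z → y ≡ toℚ z
∈ℤ-if-coprime-multiples-∈ℤ i j k coprime {y} {i′} {j′} {k′} yi yj yk =
  let u , v , w , bézout-eq = bézout₃ i j k
  in u * i′ + v * j′ + w * k′ , (begin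
    y                                                   ≡⟨ ℚP.*-identityʳ y ⟨
    y ℚ.* toℚ (+ 1)                                     ≡⟨ cong (λ m → y ℚ.* toℚ (+ m)) coprime ⟨
    y ℚ.* toℚ (+ content [ i , j , k ])                 ≡⟨ cong (λ m → y ℚ.* toℚ m) bézout-eq ⟩
    y ℚ.* toℚ (u * i + v * j + w * k)                   ≡⟨ cong (y ℚ.*_) (toℚ-*+*+* u i v j w k) ⟩
    y ℚ.* (toℚ u ℚ.* toℚ i ℚ.+ toℚ v ℚ.* toℚ j ℚ.+ toℚ w ℚ.* toℚ k)
                                                        ≡⟨ distrib y (toℚ u) (toℚ i) (toℚ v) (toℚ j) (toℚ w) (toℚ k) ⟩
    toℚ u ℚ.* (y ℚ.* toℚ i) ℚ.+ toℚ v ℚ.* (y ℚ.* toℚ j) ℚ.+ toℚ w ℚ.* (y ℚ.* toℚ k)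
                                                        ≡⟨ cong₂ ℚ._+_ (cong₂ (λ a b → toℚ u ℚ.* a ℚ.+ toℚ v ℚ.* b) yi yj)
                                                                      (cong (toℚ w ℚ.*_) yk) ⟩
    toℚ u ℚ.* toℚ i′ ℚ.+ toℚ v ℚ.* toℚ j′ ℚ.+ toℚ w ℚ.* toℚ k′
                                                        ≡⟨ toℚ-*+*+* u i′ v j′ w k′ ⟨
    toℚ (u * i′ + v * j′ + w * k′)                      ∎)
  where
  open ≡-Reasoning
  distrib : ∀ y u i v j w k →
    y ℚ.* (u ℚ.* i ℚ.+ v ℚ.* j ℚ.+ w ℚ.* k) ≡ u ℚ.* (y ℚ.* i) ℚ.+ v ℚ.* (y ℚ.* j) ℚ.+ w ℚ.* (y ℚ.* k)
  distrib = RingSolver.solve-∀ ℚ-ring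

substω-integral⇒∈O : ∀ {a b c d} → Primitive [ c , d - a , - b ] →
  ∀ k {a′ b′ c′ d′} → substω (intMat a b c d) k ≡ intMat a′ b′ c′ d′ → ∃₂ λ x y → k ≡ toℚ x +ω toℚ y
substω-integral⇒∈O {a} {b} {c} {d} prim (x +ω y) {a′} {b′} {c′} {d′} eq =
  let z , y≡z = ∈ℤ-if-coprime-multiples-∈ℤ c (d - a) (- b) prim {y} {c′} {d′ - a′} { - b′ }
                  (cong M2.e21 eq) y[d-a] y[-b]
  in a′ - z * a , z , cong₂ _+ω_ (x∈ℤ z y≡z) y≡z
  where
  open ≡-Reasoning
  e₁₁ = cong M2.e11 eq
  difference : ∀ x y a d → y ℚ.* (d ℚ.- a) ≡ (x ℚ.+ y ℚ.* d) ℚ.- (x ℚ.+ y ℚ.* a)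
  difference = RingSolver.solve-∀ ℚ-ring
  y[d-a] : y ℚ.* toℚ (d - a) ≡ toℚ (d′ - a′)
  y[d-a] = begin
    y ℚ.* toℚ (d - a)                                 ≡⟨ cong (y ℚ.*_) (toℚ-sub d a) ⟩
    y ℚ.* (toℚ d ℚ.- toℚ a)                           ≡⟨ difference x y (toℚ a) (toℚ d) ⟩
    (x ℚ.+ y ℚ.* toℚ d) ℚ.- (x ℚ.+ y ℚ.* toℚ a)       ≡⟨ cong₂ ℚ._-_ (cong M2.e22 eq) e₁₁ ⟩
    toℚ d′ ℚ.- toℚ a′                                 ≡⟨ toℚ-sub d′ a′ ⟨
    toℚ (d′ - a′)                                     ∎
  y[-b] : y ℚ.* toℚ (- b) ≡ toℚ (- b′)
  y[-b] = begin
    y ℚ.* toℚ (- b)       ≡⟨ cong (y ℚ.*_) (toℚ-neg b) ⟩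
    y ℚ.* ℚ.- toℚ b       ≡⟨ ℚP.neg-distribʳ-* y (toℚ b) ⟨
    ℚ.- (y ℚ.* toℚ b)     ≡⟨ cong ℚ.-_ (cong M2.e12 eq) ⟩
    ℚ.- toℚ b′            ≡⟨ toℚ-neg b′ ⟨
    toℚ (- b′)            ∎
  x∈ℤ : ∀ z → y ≡ toℚ z → x ≡ toℚ (a′ - z * a)
  x∈ℤ z y≡z = begin
    x                                   ≡⟨ cancel x (y ℚ.* toℚ a) ⟨
    (x ℚ.+ y ℚ.* toℚ a) ℚ.- y ℚ.* toℚ a  ≡⟨ cong₂ (λ u v → u ℚ.- v ℚ.* toℚ a) e₁₁ y≡z ⟩
    toℚ a′ ℚ.- toℚ z ℚ.* toℚ a           ≡⟨ cong (ℚ._-_ (toℚ a′)) (toℚ-* z a) ⟨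
    toℚ a′ ℚ.- toℚ (z * a)               ≡⟨ toℚ-sub a′ (z * a) ⟨
    toℚ (a′ - z * a)                     ∎
    where
    cancel : ∀ x v → x ℚ.+ v ℚ.- v ≡ x
    cancel = RingSolver.solve-∀ ℚ-ring

y*toℚ[z*g]≡toℚ[z] : ∀ {g y} z → toℚ g ℚ.* y ≡ 1ℚ → y ℚ.* toℚ (z * g) ≡ toℚ z
y*toℚ[z*g]≡toℚ[z] {g} {y} z gy≡1 = begin
  y ℚ.* toℚ (z * g)          ≡⟨ cong (y ℚ.*_) (toℚ-* z g) ⟩
  y ℚ.* (toℚ z ℚ.* toℚ g)    ≡⟨ rearrange y (toℚ z) (toℚ g) ⟩
  toℚ z ℚ.* (toℚ g ℚ.* y)    ≡⟨ cong (toℚ z ℚ.*_) gy≡1 ⟩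
  toℚ z ℚ.* 1ℚ               ≡⟨ ℚP.*-identityʳ (toℚ z) ⟩
  toℚ z                      ∎
  where
  open ≡-Reasoning
  rearrange : ∀ y z g → y ℚ.* (z ℚ.* g) ≡ z ℚ.* (g ℚ.* y)
  rearrange = RingSolver.solve-∀ ℚ-ring

substω-[ω-a]/g : ∀ {a b c d g y} (g∣b : g ℤS.∣ b) (g∣c : g ℤS.∣ c) (g∣d-a : g ℤS.∣ d - a) →
  toℚ g ℚ.* y ≡ 1ℚ → substω (intMat a b c d) ((ℚ.- toℚ a ℚ.* y) +ω y) ≡
                     intMat (+ 0) (ℤS.quotient g∣b) (ℤS.quotient g∣c) (ℤS.quotient g∣d-a)
substω-[ω-a]/g {a} {b} {c} {d} {g} {y} (ℤS.divides b₁ b≡) (ℤS.divides c₁ c≡) (ℤS.divides e₁ d-a≡) gy≡1 =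
  mat-cong (vanish (toℚ a) y) (divide {b} {b₁} b≡) (divide {c} {c₁} c≡) (begin
    ℚ.- toℚ a ℚ.* y ℚ.+ y ℚ.* toℚ d   ≡⟨ factor (toℚ a) y (toℚ d) ⟩
    y ℚ.* (toℚ d ℚ.- toℚ a)           ≡⟨ cong (y ℚ.*_) (toℚ-sub d a) ⟨
    y ℚ.* toℚ (d - a)                 ≡⟨ divide {d - a} {e₁} d-a≡ ⟩
    toℚ e₁                            ∎)
  where
  open ≡-Reasoning
  divide : ∀ {i i₁} → i ≡ i₁ * g → y ℚ.* toℚ i ≡ toℚ i₁
  divide {i} {i₁} refl = y*toℚ[z*g]≡toℚ[z] {g} {y} i₁ gy≡1
  vanish : ∀ a y → ℚ.- a ℚ.* y ℚ.+ y ℚ.* a ≡ 0ℚ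
  vanish = RingSolver.solve-∀ ℚ-ring
  factor : ∀ a y d → ℚ.- a ℚ.* y ℚ.+ y ℚ.* d ≡ y ℚ.* (d ℚ.- a)
  factor = RingSolver.solve-∀ ℚ-ring

toℚ[g]*toℚ[z]≡1⇒g≡1 : ∀ g z → toℚ (+ g) ℚ.* toℚ z ≡ 1ℚ → g ≡ 1
toℚ[g]*toℚ[z]≡1⇒g≡1 g z gz≡1 = ℕP.m*n≡1⇒m≡1 g ∣ z ∣
  (trans (sym (ℤP.abs-* (+ g) z)) (cong ∣_∣ (toℚ-injective {+ g * z} {+ 1} (trans (toℚ-* (+ g) z) gz≡1))))

module EmbeddingMatrix {t n : ℤ} {p : ℕ} {ε : ℤ} (e : QuadField.EmbeddingIntoMns t n p ε) where
  open QuadField t n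
  open IsQAlgEmbedding (isEmb e)

  -- read off as in formOf, so that formOf t n e is definitionally [ c , d - a , - b ]
  private
    entries = OintoMns e (+ 0) (+ 1)

  a b c d : ℤ
  a = proj₁ entries
  b = proj₁ (proj₂ entries)
  c = proj₁ (proj₂ (proj₂ entries))
  d = proj₁ (proj₂ (proj₂ (proj₂ entries)))

  ι-ω : ι e ωᴷ ≡ intMat a b c d
  ι-ω = proj₁ (proj₂ (proj₂ (proj₂ (proj₂ entries))))

  a≡d : a ≡ d [mod + p ]
  a≡d = proj₁ (proj₂ (proj₂ (proj₂ (proj₂ (proj₂ entries)))))

  bε≡c : (b * ε) ≡ c [mod + p ]
  bε≡c = proj₂ (proj₂ (proj₂ (proj₂ (proj₂ (proj₂ entries)))))

  ι≗substω : ∀ k → ι e k ≡ substω (intMat a b c d) k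
  ι≗substω k = trans (ι≗substω[ιω] (isEmb e) k) (cong (λ M → substω M k) ι-ω)

  cayleyHamilton : intMat (- n + t * a) (t * b) (t * c) (- n + t * d) ≡
                   intMat (a * a + b * c) (a * b + b * d) (c * a + d * c) (c * b + d * d)
  cayleyHamilton = begin
    intMat (- n + t * a) (t * b) (t * c) (- n + t * d)   ≡⟨ substω-intMat a b c d (- n) t ⟨
    substω (intMat a b c d) (toℚ (- n) +ω toℚ t)          ≡⟨ cong (substω (intMat a b c d)) (ω*ω {t} {n}) ⟨
    substω (intMat a b c d) (ωᴷ *ᴷ ωᴷ)                    ≡⟨ ι≗substω (ωᴷ *ᴷ ωᴷ) ⟨
    ι e (ωᴷ *ᴷ ωᴷ)                                        ≡⟨ multiplicative ωᴷ ωᴷ ⟩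
    ι e ωᴷ *ᴹ ι e ωᴷ                                      ≡⟨ cong₂ _*ᴹ_ ι-ω ι-ω ⟩
    intMat a b c d *ᴹ intMat a b c d                      ≡⟨ intMat-* a b c d a b c d ⟩
    intMat (a * a + b * c) (a * b + b * d) (c * a + d * c) (c * b + d * d) ∎
    where open ≡-Reasoning

  hasCharPoly : t * t - + 4 * n < + 0 → HasCharPoly t n a b c d
  hasCharPoly disc<0 = cayleyHamilton⇒hasCharPoly disc<0
    (sym (toℚ-injective (cong M2.e11 cayleyHamilton)))
    (sym (toℚ-injective (cong M2.e12 cayleyHamilton)))

  formOf∈Qns : t * t - + 4 * n < + 0 → InQnsD p ε (t * t - + 4 * n) (formOf t n e)
  formOf∈Qns disc<0 =
    hasCharPoly⇒disc (hasCharPoly disc<0) ,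
    ∣⇒≡0-mod (subst (+ p ℤS.∣_) (flip a d) (ℤS.∣m⇒∣-m (ℤS.∣ᵤ⇒∣ a≡d))) ,
    ∣⇒≡0-mod (subst (+ p ℤS.∣_) (flip′ b c ε) (ℤS.∣m⇒∣-m (ℤS.∣ᵤ⇒∣ bε≡c)))
    where
    flip : ∀ a d → - (a - d) ≡ d - a
    flip = ℤ-Solver.solve-∀
    flip′ : ∀ b c ε → - (b * ε - c) ≡ c + (- b) * ε
    flip′ = ℤ-Solver.solve-∀

module _ {t n : ℤ} {p : ℕ} {ε : ℤ} where
  open QuadField t n

  formOf-injective : t * t - + 4 * n < + 0 → (e e′ : EmbeddingIntoMns p ε) →
                     formOf t n e ≡ formOf t n e′ → ∀ k → ι e k ≡ ι e′ k
  formOf-injective disc<0 e e′ v≡v′ k = begin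
    ι e k                                  ≡⟨ E.ι≗substω k ⟩
    substω (intMat E.a E.b E.c E.d) k      ≡⟨ cong (λ M → substω M k) M≡M′ ⟩
    substω (intMat E′.a E′.b E′.c E′.d) k  ≡⟨ E′.ι≗substω k ⟨
    ι e′ k                                 ∎
    where
    open ≡-Reasoning
    module E = EmbeddingMatrix e
    module E′ = EmbeddingMatrix e′
    M≡M′ = hasCharPoly-form-injective (E.hasCharPoly disc<0) (E′.hasCharPoly disc<0) v≡v′

module FromForm {t n : ℤ} {p : ℕ} {ε : ℤ} (disc<0 : t * t - + 4 * n < + 0)
  {A B C : ℤ} (f∈Qns : InQnsD p ε (t * t - + 4 * n) [ A , B , C ]) where
  open QuadField t n
  open ≡-Reasoning

  private
    disc[A,B,C]≡ : B * B - + 4 * A * C ≡ t * t - + 4 * n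
    disc[A,B,C]≡ = proj₁ f∈Qns

    2∣t-B : + 2 ℤS.∣ t - B
    2∣t-B = 2∣[i-j][i+j]⇒2∣i-j t B (subst (+ 2 ℤS.∣_) (sym [t-B][t+B]≡2X) (ℤS.∣m⇒∣m*n X (ℤS.∣-refl {+ 2})))
      where
      X = + 2 * (n - A * C)
      expand : ∀ t B n A C → (t - B) * (t + B) ≡ (t * t - + 4 * n) - (B * B - + 4 * A * C) + + 2 * (+ 2 * (n - A * C))
      expand = ℤ-Solver.solve-∀
      cancel : ∀ x y → x - x + y ≡ y
      cancel = ℤ-Solver.solve-∀
      [t-B][t+B]≡2X : (t - B) * (t + B) ≡ + 2 * X
      [t-B][t+B]≡2X = begin
        (t - B) * (t + B)                                      ≡⟨ expand t B n A C ⟩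
        (t * t - + 4 * n) - (B * B - + 4 * A * C) + + 2 * X    ≡⟨ cong (λ x → (t * t - + 4 * n) - x + + 2 * X) disc[A,B,C]≡ ⟩
        (t * t - + 4 * n) - (t * t - + 4 * n) + + 2 * X        ≡⟨ cancel (t * t - + 4 * n) (+ 2 * X) ⟩
        + 2 * X                                                ∎

  h : ℤ
  h = ℤS._∣_.quotient 2∣t-B

  private
    t≡2h+B : t ≡ h * + 2 + B
    t≡2h+B = begin
      t             ≡⟨ cancel t B ⟨
      t - B + B     ≡⟨ cong (_+ B) (ℤS._∣_.equality 2∣t-B) ⟩
      h * + 2 + B   ∎
      where
      cancel : ∀ t B → t - B + B ≡ t
      cancel = ℤ-Solver.solve-∀

  hasCharPoly : HasCharPoly t n h (- C) A (h + B)
  hasCharPoly = mkHasCharPoly trace det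
    where
    trace : h + (h + B) ≡ t
    trace = trans (double h B) (sym t≡2h+B)
      where
      double : ∀ h B → h + (h + B) ≡ h * + 2 + B
      double = ℤ-Solver.solve-∀
    four-det : ∀ h B A C → + 4 * (h * (h + B) - (- C) * A) ≡ (h * + 2 + B) * (h * + 2 + B) - (B * B - + 4 * A * C)
    four-det = ℤ-Solver.solve-∀
    cancel : ∀ t n → t * t - (t * t - + 4 * n) ≡ + 4 * n
    cancel = ℤ-Solver.solve-∀
    det : h * (h + B) - (- C) * A ≡ n
    det = ℤP.*-cancelˡ-≡ (+ 4) (h * (h + B) - (- C) * A) n (begin
      + 4 * (h * (h + B) - (- C) * A)                           ≡⟨ four-det h B A C ⟩
      (h * + 2 + B) * (h * + 2 + B) - (B * B - + 4 * A * C)     ≡⟨ cong₂ (λ x y → x * x - y) (sym t≡2h+B) disc[A,B,C]≡ ⟩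
      t * t - (t * t - + 4 * n)                                 ≡⟨ cancel t n ⟩
      + 4 * n                                                   ∎)

  embedding : EmbeddingIntoMns p ε
  embedding = record
    { ι        = substω (intMat h (- C) A (h + B))
    ; isEmb    = substω-intMat-isQAlgEmbedding hasCharPoly (hasCharPoly⇒b≢0 disc<0 hasCharPoly)
    ; OintoMns = λ x y → x + y * h , y * (- C) , y * A , x + y * (h + B) ,
                         substω-intMat h (- C) A (h + B) x y , diagonal x y , off-diagonal y
    }
    where
    diagonal : ∀ x y → (x + y * h) ≡ (x + y * (h + B)) [mod + p ]
    diagonal x y = ℤS.∣⇒∣ᵤ (subst (+ p ℤS.∣_) (shift x y h B)
                     (ℤS.∣m⇒∣-m (ℤS.∣n⇒∣m*n y (≡0-mod⇒∣ (proj₁ (proj₂ f∈Qns))))))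
      where
      shift : ∀ x y h B → - (y * B) ≡ (x + y * h) - (x + y * (h + B))
      shift = ℤ-Solver.solve-∀
    off-diagonal : ∀ y → (y * (- C) * ε) ≡ (y * A) [mod + p ]
    off-diagonal y = ℤS.∣⇒∣ᵤ (subst (+ p ℤS.∣_) (shift y A C ε)
                       (ℤS.∣m⇒∣-m (ℤS.∣n⇒∣m*n y (≡0-mod⇒∣ (proj₂ (proj₂ f∈Qns))))))
      where
      shift : ∀ y A C ε → - (y * (A + C * ε)) ≡ y * (- C) * ε - y * A
      shift = ℤ-Solver.solve-∀

  formOf-embedding : formOf t n embedding ≡ [ A , B , C ]
  formOf-embedding = cong₂ (λ x y → [ x , proj₁ y , proj₂ y ])
    (ℤP.*-identityˡ A) (cong₂ _,_ (difference h B) (negate C))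
    where
    difference : ∀ h B → (+ 0 + + 1 * (h + B)) - (+ 0 + + 1 * h) ≡ B
    difference = ℤ-Solver.solve-∀
    negate : ∀ C → - (+ 1 * (- C)) ≡ C
    negate = ℤ-Solver.solve-∀

module Optimality {t n : ℤ} {p : ℕ} {ε : ℤ} (e : QuadField.EmbeddingIntoMns t n p ε) where
  open QuadField t n
  open IsQAlgEmbedding (isEmb e)
  open EmbeddingMatrix e

  content≡1⇒optimal : Primitive (formOf t n e) → Optimal e
  content≡1⇒optimal prim k (a′ , b′ , c′ , d′ , ιk≡ , _) =
    k , substω-integral⇒∈O {a} {b} {c} {d} prim k {a′} {b′} {c′} {d′} (trans (sym (ι≗substω k)) ιk≡) , refl

  optimal⇒common-divisor≡1 : Prime p → Optimal e → ∀ {g} → g ≢ 0 → ¬ p ℕD.∣ g →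
    + g ℤS.∣ b → + g ℤS.∣ c → + g ℤS.∣ d - a → g ≡ 1
  optimal⇒common-divisor≡1 p-prime optimal {g} g≢0 p∤g g∣b g∣c g∣d-a =
    let o , (_ , z , o≡) , ιk≡ιo = optimal k (+ 0 , b₁ , c₁ , e₁ , ι-k , 0≡e₁ , b₁ε≡c₁)
        y≡z = cong K.im (trans (injective k o ιk≡ιo) o≡)
    in toℚ[g]*toℚ[z]≡1⇒g≡1 g z (trans (cong (G ℚ.*_) (sym y≡z)) (ℚP.*-inverseʳ G))
    where
    open ℤS._∣_ g∣b renaming (quotient to b₁; equality to b≡)
    open ℤS._∣_ g∣c renaming (quotient to c₁; equality to c≡)
    open ℤS._∣_ g∣d-a renaming (quotient to e₁; equality to d-a≡)
    G = toℚ (+ g)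
    G≢0 : G ≢ 0ℚ
    G≢0 = g≢0 ∘ cong ∣_∣ ∘ toℚ-injective {+ g} {+ 0}
    instance _ = ℚ.≢-nonZero G≢0
    y = ℚ.1/ G
    k = (ℚ.- toℚ a ℚ.* y) +ω y
    ι-k : ι e k ≡ intMat (+ 0) b₁ c₁ e₁
    ι-k = trans (ι≗substω k) (substω-[ω-a]/g {a = a} {d = d} {y = y} g∣b g∣c g∣d-a (ℚP.*-inverseʳ G))
    a-d≡ : a - d ≡ + 0 * + g - e₁ * + g
    a-d≡ = trans (flip a d (+ g)) (cong (λ x → + 0 * + g - x) d-a≡)
      where
      flip : ∀ a d g → a - d ≡ + 0 * g - (d - a)
      flip = ℤ-Solver.solve-∀
    0≡e₁ : (+ 0) ≡ e₁ [mod + p ]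
    0≡e₁ = ≡-mod-cancelʳ (+ 0) e₁ (+ g) p-prime p∤g (subst (+ p ℤD.∣_) a-d≡ a≡d)
    bε-c≡ : b * ε - c ≡ b₁ * ε * + g - c₁ * + g
    bε-c≡ = trans (cong₂ (λ u v → u * ε - v) b≡ c≡) (rearrange b₁ (+ g) ε c₁)
      where
      rearrange : ∀ b₁ g ε c₁ → b₁ * g * ε - c₁ * g ≡ b₁ * ε * g - c₁ * g
      rearrange = ℤ-Solver.solve-∀
    b₁ε≡c₁ : (b₁ * ε) ≡ c₁ [mod + p ]
    b₁ε≡c₁ = ≡-mod-cancelʳ (b₁ * ε) c₁ (+ g) p-prime p∤g (subst (+ p ℤD.∣_) bε-c≡ bε≡c)

  optimal⇒content≡1 : Prime p → t * t - + 4 * n < + 0 → ¬ (+ p ℤD.∣ t * t - + 4 * n) →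
                      Optimal e → Primitive (formOf t n e)
  optimal⇒content≡1 p-prime disc<0 p∤disc optimal =
    optimal⇒common-divisor≡1 p-prime optimal g≢0 p∤g g∣b g∣c g∣d-a
    where
    g = content (formOf t n e)
    g∣c = content∣A c (d - a) (- b)
    g∣d-a = content∣B c (d - a) (- b)
    g∣-b = content∣C c (d - a) (- b)
    g∣b : + g ℤS.∣ b
    g∣b = subst (+ g ℤS.∣_) (ℤP.neg-involutive b) (ℤS.∣m⇒∣-m g∣-b)
    g≢0 : g ≢ 0
    g≢0 = hasCharPoly⇒b≢0 disc<0 (hasCharPoly disc<0) ∘ ℤP.neg-injective ∘ content≡0⇒C≡0 c (d - a) (- b)
    p∤g : ¬ p ℕD.∣ g
    p∤g p∣g = p∤disc (ℤS.∣⇒∣ᵤ (subst (+ p ℤS.∣_) (hasCharPoly⇒disc (hasCharPoly disc<0))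
                (∣-disc (p∣ g∣c) (p∣ g∣d-a) (p∣ g∣-b))))
      where
      p∣ : ∀ {i} → + g ℤS.∣ i → + p ℤS.∣ i
      p∣ = ℤS.∣-trans (ℤS.∣ᵤ⇒∣ {+ p} {+ g} p∣g)

proposition4p1 :
  (p : ℕ) → Prime p → p ≢ 2 →
  (ε : ℤ) → ¬ IsSquareMod ε (+ p) → ε ≡ + 1 [mod + 4 ] →
  (t n D : ℤ) → D ≡ t * t - + 4 * n → D < + 0 →
  ¬ IsSquareMod D (+ p) →
  ¬ (+ p ∣ D) →
  ((e : QuadField.EmbeddingIntoMns t n p ε) → InQnsD p ε D (formOf t n e))
  × ((e e' : QuadField.EmbeddingIntoMns t n p ε) → formOf t n e ≡ formOf t n e' →
       (k : K) → QuadField.EmbeddingIntoMns.ι e k ≡ QuadField.EmbeddingIntoMns.ι e' k)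
  × ((f : QForm) → InQnsD p ε D f →
       Σ (QuadField.EmbeddingIntoMns t n p ε) (λ e → formOf t n e ≡ f))
  × ((e : QuadField.EmbeddingIntoMns t n p ε) →
       QuadField.Optimal t n e ⇔ Primitive (formOf t n e))
proposition4p1 p p-prime _ ε _ _ t n _ refl disc<0 _ p∤disc =
    (λ e → EmbeddingMatrix.formOf∈Qns e disc<0)
  , formOf-injective disc<0
  , fromForm
  , (λ e → mk⇔ (Optimality.optimal⇒content≡1 e p-prime disc<0 p∤disc) (Optimality.content≡1⇒optimal e))
  where
  fromForm : (f : QForm) → InQnsD p ε (t * t - + 4 * n) f →
             Σ (QuadField.EmbeddingIntoMns t n p ε) (λ e → formOf t n e ≡ f)
  fromForm [ A , B , C ] f∈Qns = embedding , formOf-embedding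
    where open FromForm {t} {n} {p} {ε} disc<0 {A} {B} {C} f∈Qns
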